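{- Let $n\ge 3$ and let $\overrightarrow{C_n}$ be a $\Theta$-oriented cycle. For a nonempty set $D\subseteq\{0,1,\dots,n-2\}$, $\overrightarrow{C_n}$ is $D$-antimagic if and only if $\min(D)\le 1$.
   Context: A $\Theta$-oriented cycle $\overrightarrow{C_n}$ has vertices $v_1,\dots,v_n$ and arc set $\{(v_i,v_{i+1}):1\le i\le n-1\}\cup\{(v_1,v_n)\}$ (exactly one source $v_1$ and one sink $v_n$, adjacent); its finite distances are $0,1,\dots,n-2$. $d(u,y)$ is the length of a shortest directed path from $u$ to $y$ ($d(u,u)=0$, $\infty$ if none). $N_D(v)=\{y: d(v,y)\in D\}$; a bijection $f:V\to\{1,\dots,n\}$ is $D$-antimagic if $\omega_D(v)=\sum_{y\in N_D(v)}f(y)$ are pairwise distinct over all vertices $v$; the graph is $D$-antimagic if such a bijection exists. -}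

module Defs where

open import Data.Nat using (ℕ; zero; suc; _+_; _∸_; _<_; _≤_)
open import Data.Nat.Properties using () renaming (_≟_ to _≟ℕ_)
open import Data.Bool using (Bool; true; false; _∧_; _∨_; not; if_then_else_)
open import Data.Fin using (Fin; toℕ)
open import Data.Fin.Properties using () renaming (_≟_ to _≟F_)
open import Data.Fin.Subset using (Subset; _∈_)
open import Data.Fin.Permutation using (Permutation′; _⟨$⟩ʳ_)
open import Data.Vec using (lookup)
open import Data.List using (List; map; allFin; upTo)
open import Data.Bool.ListAction using (any)
open import Data.Nat.ListAction using (sum)
open import Data.Product using (Σ; _×_; ∃)
open import Relation.Nullary.Decidable using (⌊_⌋)
open import Relation.Binary.PropositionalEquality using (_≡_)
open import Function.Definitions using (Injective)

-- Vertices v_1,…,v_n are represented by Fin n (v_i ↦ index i-1).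
-- Arc relation of the Θ-oriented cycle: (v_i,v_{i+1}) for 1≤i≤n-1, and (v_1,v_n).
arc : (n : ℕ) → Fin n → Fin n → Bool
arc n i j = ⌊ toℕ j ≟ℕ suc (toℕ i) ⌋ ∨ (⌊ toℕ i ≟ℕ 0 ⌋ ∧ ⌊ toℕ j ≟ℕ (n ∸ 1) ⌋)

walk : (n : ℕ) → ℕ → Fin n → Fin n → Bool
walk n zero    u y = ⌊ u ≟F y ⌋
walk n (suc k) u y = any (λ z → arc n u z ∧ walk n k z y) (allFin n)

distIs : (n : ℕ) → Fin n → Fin n → ℕ → Bool
distIs n u y k = walk n k u y ∧ not (any (λ j → walk n j u y) (upTo k))

-- y ∈ N_D(v) : d(v,y) ∈ D, where D ⊆ {0,…,n-2} is a Subset (n ∸ 1),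
-- element i : Fin (n ∸ 1) standing for the distance toℕ i.
inN : (n : ℕ) → Subset (n ∸ 1) → Fin n → Fin n → Bool
inN n D v y = any (λ i → lookup D i ∧ distIs n v y (toℕ i)) (allFin (n ∸ 1))

-- Labels: a bijection f : V → {1,…,n} is given as a permutation π of Fin n,
-- with f(v) = 1 + toℕ (π v).
label : (n : ℕ) → Permutation′ n → Fin n → ℕ
label n π v = suc (toℕ (π ⟨$⟩ʳ v))

weight : (n : ℕ) → Subset (n ∸ 1) → Permutation′ n → Fin n → ℕ
weight n D π v = sum (map (λ y → if inN n D v y then label n π y else 0) (allFin n))

IsDAntimagicLabeling : (n : ℕ) → Subset (n ∸ 1) → Permutation′ n → Set
IsDAntimagicLabeling n D π = Injective _≡_ _≡_ (weight n D π)

ThetaCycleDAntimagic : (n : ℕ) → Subset (n ∸ 1) → Set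
ThetaCycleDAntimagic n D = Σ (Permutation′ n) (IsDAntimagicLabeling n D)

MinAtMostOne : (n : ℕ) → Subset (n ∸ 1) → Set
MinAtMostOne n D = ∃ λ i → i ∈ D × toℕ i ≤ 1

-- With the reverse labelling f(v_i) = n + 1 − i, every vertex v_i other than the sink
-- satisfies ω(v_i) = ω(v_{i+1}) + |N_D(v_i)|: away from the arc v_1 → v_n the cycle is
-- invariant under the shift v_j ↦ v_{j+1}, which lowers every label by one, while the
-- sink, if it lies in N_D(v_i), contributes its label 1 to ω(v_i) alone. If some d ≤ 1
-- lies in D then v_{i+d} ∈ N_D(v_i), so the weights strictly decrease and f is D-antimagic.
-- If min D ≥ 2, the vertices v_{n-1} and v_n reach nothing at distance ≥ 2, so both have
-- weight 0 under every labelling.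

module Submission where

open import Defs
open import Data.Nat using (ℕ; _≤_; _∸_)
open import Data.Fin.Subset using (Subset; Nonempty)
open import Function.Bundles using (_⇔_)

open import Data.Bool using (Bool; true; false; _∧_; not; if_then_else_; T)
open import Data.Bool.Properties using (T-≡; T-∧; T-∨)
open import Data.Bool.ListAction using (any)
open import Data.Empty using (⊥-elim)
open import Data.Fin using (Fin; zero; suc; toℕ; fromℕ; fromℕ<)
open import Data.Fin.Permutation using (reverse)
open import Data.Fin.Properties
  using (toℕ-injective; toℕ-fromℕ; toℕ-fromℕ<; toℕ-inject₁; toℕ<n; toℕ≤pred[n]; opposite-prop; any?)
  renaming (_≟_ to _≟F_)
open import Data.Fin.Subset using (_∈_)
open import Data.Fin.Subset.Properties using (_∈?_)
open import Data.List using (map; tabulate; allFin; upTo)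
open import Data.List.Properties using (map-tabulate)
open import Data.List.Relation.Unary.Any.Properties
  using (any⁺; any⁻; tabulate⁺; tabulate⁻; applyUpTo⁺; applyUpTo⁻)
open import Data.Nat using (zero; suc; pred; _+_; _<_; _≤?_; s≤s; z<s; NonZero; ≢-nonZero)
open import Data.Nat.Properties
import Data.Nat.ListAction as List
open import Algebra.Properties.CommutativeMonoid.Sum +-0-commutativeMonoid
  using (sum-syntax; ∑-distrib-+; sum-init-last; sum-cong-≗; sum-replicate-zero)
  renaming (sum to ∑)
open import Data.Product using (∃; _×_; _,_; proj₂; map₂)
open import Data.Product.Function.NonDependent.Propositional using (_×-⇔_)
open import Data.Sum using (_⊎_; inj₁; inj₂)
open import Data.Sum.Function.Propositional using (_⊎-⇔_)
open import Data.Vec using (lookup)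
open import Data.Vec.Properties using ([]=↔lookup)
open import Function.Base using (_∘_; const)
open import Function.Bundles using (Equivalence; mk⇔)
import Function.Properties.Equivalence as ⇔
open import Function.Properties.Inverse using (↔⇒⇔)
open import Relation.Binary using (tri<; tri≈; tri>)
open import Relation.Binary.PropositionalEquality
open import Relation.Nullary using (¬_; Dec; yes; no; does)
open import Relation.Nullary.Decidable
  using (⌊_⌋; _×-dec_; _⊎-dec_; ¬?; T?; does-⇔; dec-true; dec-false; decidable-stable)

open Equivalence using (to; from)

T-⌊⌋ : ∀ {a} {A : Set a} (a? : Dec A) → T ⌊ a? ⌋ ⇔ A
T-⌊⌋ (yes a) = mk⇔ (const a) (const _)
T-⌊⌋ (no ¬a) = mk⇔ (λ ()) ¬a

T-not : ∀ {x} → T (not x) ⇔ (¬ T x)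
T-not {true}  = mk⇔ (λ ()) (λ ¬t → ¬t _)
T-not {false} = mk⇔ (λ _ ()) (const _)

T-any-allFin : ∀ {k} {p : Fin k → Bool} → T (any p (allFin k)) ⇔ ∃ (T ∘ p)
T-any-allFin {p = p} = mk⇔ (tabulate⁻ ∘ any⁻ p _) (λ (i , pi) → any⁺ p (tabulate⁺ i pi))

T-any-upTo : ∀ {k} {p : ℕ → Bool} → T (any p (upTo k)) ⇔ ∃ λ j → j < k × T (p j)
T-any-upTo {p = p} = mk⇔ (applyUpTo⁻ _ ∘ any⁻ p _) (λ (j , j<k , pj) → any⁺ p (applyUpTo⁺ _ pj j<k))

∃-cong-⇔ : ∀ {A : Set} {P Q : A → Set} → (∀ {x} → P x ⇔ Q x) → ∃ P ⇔ ∃ Q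
∃-cong-⇔ P⇔Q = mk⇔ (map₂ (to P⇔Q)) (map₂ (from P⇔Q))

T-lookup : ∀ {k} {D : Subset k} {i} → T (lookup D i) ⇔ i ∈ D
T-lookup = ⇔.trans T-≡ (⇔.sym (↔⇒⇔ []=↔lookup))

sum-tabulate : ∀ {k} (f : Fin k → ℕ) → List.sum (tabulate f) ≡ ∑ f
sum-tabulate {zero}  f = refl
sum-tabulate {suc k} f = cong (f zero +_) (sum-tabulate (f ∘ suc))

sum-allFin : ∀ {k} (f : Fin k → ℕ) → List.sum (map f (allFin k)) ≡ ∑ f
sum-allFin f = trans (cong List.sum (map-tabulate (λ i → i) f)) (sum-tabulate f)

sum-init-lastℕ : ∀ k (f : ℕ → ℕ) → ∑[ i < suc k ] f (toℕ i) ≡ ∑[ i < k ] f (toℕ i) + f k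
sum-init-lastℕ k f =
  trans (sum-init-last {k} (f ∘ toℕ))
        (cong₂ _+_ (sum-cong-≗ {k} (cong f ∘ toℕ-inject₁)) (cong f (toℕ-fromℕ k)))

term≤sum : ∀ {k} (f : Fin k → ℕ) i → f i ≤ ∑ f
term≤sum f zero    = m≤m+n (f zero) _
term≤sum f (suc i) = ≤-trans (term≤sum (f ∘ suc) i) (m≤n+m _ (f zero))

StepDecreasingUpTo : ℕ → (ℕ → ℕ) → Set
StepDecreasingUpTo N f = ∀ a → a < N → f (suc a) < f a

module _ {N : ℕ} {f : ℕ → ℕ} (f-step : StepDecreasingUpTo N f) where

  stepDecreasing⇒decreasing : ∀ {a b} → a < b → b ≤ N → f b < f a
  stepDecreasing⇒decreasing {a} {suc b} (s≤s a≤b) b<N with m≤n⇒m<n∨m≡n a≤b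
  ... | inj₁ a<b  = <-trans (f-step b b<N) (stepDecreasing⇒decreasing a<b (<⇒≤ b<N))
  ... | inj₂ refl = f-step b b<N

  stepDecreasing⇒injective : ∀ {a b} → a ≤ N → b ≤ N → f a ≡ f b → a ≡ b
  stepDecreasing⇒injective {a} {b} a≤N b≤N fa≡fb with <-cmp a b
  ... | tri< a<b _ _ = ⊥-elim (<⇒≢ (stepDecreasing⇒decreasing a<b b≤N) (sym fa≡fb))
  ... | tri≈ _ a≡b _ = a≡b
  ... | tri> _ _ b<a = ⊥-elim (<⇒≢ (stepDecreasing⇒decreasing b<a a≤N) fa≡fb)

-- Vertex v_{a+1} is read as a ∈ {0,…,N}; the arcs are a → a+1 and 0 → N.
module ThetaCycle (N : ℕ) (2≤N : 2 ≤ N) where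

  Arc : ℕ → ℕ → Set
  Arc a c = c ≡ suc a ⊎ (a ≡ 0 × c ≡ N)

  Walk : ℕ → ℕ → ℕ → Set
  Walk k a b = b ≡ a + k ⊎ (a ≡ 0 × k ≡ 1 × b ≡ N)

  Shortest : ℕ → ℕ → ℕ → Set
  Shortest k a b = Walk k a b × (∀ j → j < k → ¬ Walk j a b)

  Dist : ℕ → ℕ → ℕ → Set
  Dist a b k = (a ≡ 0 × b ≡ N × k ≡ 1) ⊎ (¬ (a ≡ 0 × b ≡ N) × a ≤ b × k ≡ b ∸ a)

  dist? : ∀ a b k → Dec (Dist a b k)
  dist? a b k =
    (a ≟ 0 ×-dec b ≟ N ×-dec k ≟ 1) ⊎-dec (¬? (a ≟ 0 ×-dec b ≟ N) ×-dec a ≤? b ×-dec k ≟ b ∸ a)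

  N≢0 : N ≢ 0
  N≢0 = m<n⇒n≢0 2≤N

  walk-cons : ∀ {a b c k} → b ≤ N → Arc a c → Walk k c b → Walk (suc k) a b
  walk-cons {a} {k = k} _ (inj₁ refl) (inj₁ refl) = inj₁ (sym (+-suc a k))
  walk-cons _ (inj₁ refl) (inj₂ (() , _))
  walk-cons {k = zero}  _   (inj₂ (refl , refl)) (inj₁ refl) = inj₂ (refl , refl , +-identityʳ N)
  walk-cons {k = suc k} b≤N (inj₂ (refl , refl)) (inj₁ refl) = ⊥-elim (m+1+n≰m N b≤N)
  walk-cons _ (inj₂ (refl , refl)) (inj₂ (N≡0 , _)) = ⊥-elim (N≢0 N≡0)

  walk-uncons : ∀ {a b k} → b ≤ N → Walk (suc k) a b → ∃ λ c → c ≤ N × Arc a c × Walk k c b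
  walk-uncons {a} {k = k} b≤N (inj₁ refl) = suc a , ≤-trans (m<m+n a z<s) b≤N , inj₁ refl , inj₁ (+-suc a k)
  walk-uncons _ (inj₂ (refl , refl , refl)) = N , ≤-refl , inj₂ (refl , refl) , inj₁ (sym (+-identityʳ N))

  shortest⇒dist : ∀ {a b k} → Shortest k a b → Dist a b k
  shortest⇒dist (inj₂ (a≡0 , k≡1 , b≡N) , _) = inj₁ (a≡0 , b≡N , k≡1)
  shortest⇒dist {a} {k = k} (inj₁ refl , minimal) = inj₂ (no-wrap , m≤m+n a k , sym (m+n∸m≡n a k))
    where
    no-wrap : ¬ (a ≡ 0 × a + k ≡ N)
    no-wrap (refl , refl) = minimal 1 2≤N (inj₂ (refl , refl , refl))

  dist⇒shortest : ∀ {a b k} → Dist a b k → Shortest k a b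
  dist⇒shortest (inj₁ (refl , refl , refl)) = inj₂ (refl , refl , refl) , no-loop
    where
    no-loop : ∀ j → j < 1 → ¬ Walk j 0 N
    no-loop zero _ (inj₁ N≡0)       = N≢0 N≡0
    no-loop zero _ (inj₂ (_ , () , _))
    no-loop (suc j) (s≤s ())
  dist⇒shortest {a} {b} (inj₂ (no-wrap , a≤b , refl)) = inj₁ (sym (m+[n∸m]≡n a≤b)) , minimal
    where
    minimal : ∀ j → j < b ∸ a → ¬ Walk j a b
    minimal j j<j (inj₁ refl)             = <-irrefl refl (subst (j <_) (m+n∸m≡n a j) j<j)
    minimal j _   (inj₂ (a≡0 , _ , b≡N)) = no-wrap (a≡0 , b≡N)

  shortest⇔dist : ∀ {a b k} → Shortest k a b ⇔ Dist a b k
  shortest⇔dist = mk⇔ shortest⇒dist dist⇒shortest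

  dist-shift : ∀ {a b k} → b < N → Dist (suc a) (suc b) k ⇔ Dist a b k
  dist-shift {a} {b} {k} b<N = mk⇔ down up
    where
    down : Dist (suc a) (suc b) k → Dist a b k
    down (inj₂ (_ , s≤s a≤b , k≡b∸a)) = inj₂ ((λ (_ , b≡N) → <⇒≢ b<N b≡N) , a≤b , k≡b∸a)
    up : Dist a b k → Dist (suc a) (suc b) k
    up (inj₁ (_ , b≡N , _))        = ⊥-elim (<⇒≢ b<N b≡N)
    up (inj₂ (_ , a≤b , k≡b∸a)) = inj₂ ((λ ()) , s≤s a≤b , k≡b∸a)

  ¬dist-to-0 : ∀ {a k} → ¬ Dist (suc a) 0 k
  ¬dist-to-0 (inj₂ (_ , () , _))

  dist-from-top : ∀ {a b k} → N ≤ suc a → b ≤ N → Dist a b k → k ≤ 1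
  dist-from-top N≤1 _ (inj₁ (refl , _ , _)) = ⊥-elim (1+n≰n (≤-trans 2≤N N≤1))
  dist-from-top {a} {b} N≤1+a b≤N (inj₂ (_ , _ , refl)) =
    ≤-trans (∸-monoˡ-≤ a b≤N) (m≤n+o⇒m∸n≤o N a (subst (N ≤_) (+-comm 1 a) N≤1+a))

  dist-to-a+k : ∀ {a k} → a < N → k ≤ 1 → a + k ≤ N × Dist a (a + k) k
  dist-to-a+k {a} {k} a<N k≤1 =
    ≤-trans (+-monoʳ-≤ a k≤1) (subst (_≤ N) (+-comm 1 a) a<N) ,
    inj₂ (no-wrap , m≤m+n a k , sym (m+n∸m≡n a k))
    where
    no-wrap : ¬ (a ≡ 0 × a + k ≡ N)
    no-wrap (refl , refl) = 1+n≰n (≤-trans 2≤N k≤1)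

  toℕ≤N : (v : Fin (suc N)) → toℕ v ≤ N
  toℕ≤N = toℕ≤pred[n]

  T-arc : ∀ u z → T (arc (suc N) u z) ⇔ Arc (toℕ u) (toℕ z)
  T-arc u z = ⇔.trans T-∨
    (T-⌊⌋ (toℕ z ≟ suc (toℕ u)) ⊎-⇔ ⇔.trans T-∧ (T-⌊⌋ (toℕ u ≟ 0) ×-⇔ T-⌊⌋ (toℕ z ≟ N)))

  T-walk : ∀ k u y → T (walk (suc N) k u y) ⇔ Walk k (toℕ u) (toℕ y)
  T-walk zero u y = ⇔.trans (T-⌊⌋ (u ≟F y)) (mk⇔ ≡⇒walk₀ walk₀⇒≡)
    where
    ≡⇒walk₀ : u ≡ y → Walk 0 (toℕ u) (toℕ y)
    ≡⇒walk₀ refl = inj₁ (sym (+-identityʳ (toℕ u)))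
    walk₀⇒≡ : Walk 0 (toℕ u) (toℕ y) → u ≡ y
    walk₀⇒≡ (inj₁ y≡u+0) = toℕ-injective (sym (trans y≡u+0 (+-identityʳ (toℕ u))))
    walk₀⇒≡ (inj₂ (_ , () , _))
  T-walk (suc k) u y = ⇔.trans T-any-allFin (mk⇔ cons uncons)
    where
    cons : ∃ (λ z → T (arc (suc N) u z ∧ walk (suc N) k z y)) → Walk (suc k) (toℕ u) (toℕ y)
    cons (z , uzy) = let (uz , zy) = to T-∧ uzy in
      walk-cons (toℕ≤N y) (to (T-arc u z) uz) (to (T-walk k z y) zy)
    uncons : Walk (suc k) (toℕ u) (toℕ y) → ∃ (λ z → T (arc (suc N) u z ∧ walk (suc N) k z y))
    uncons w with walk-uncons (toℕ≤N y) w
    ... | c , c≤N , uc , cy = z , from T-∧ (from (T-arc u z) (subst (Arc _) (sym toℕz≡c) uc) ,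
                                            from (T-walk k z y) (subst (λ c → Walk k c _) (sym toℕz≡c) cy))
      where
      z = fromℕ< (s≤s c≤N)
      toℕz≡c = toℕ-fromℕ< (s≤s c≤N)

  T-distIs : ∀ u y k → T (distIs (suc N) u y k) ⇔ Dist (toℕ u) (toℕ y) k
  T-distIs u y k = ⇔.trans T-∧ (⇔.trans (T-walk k u y ×-⇔ ⇔.trans T-not no-shorter) shortest⇔dist)
    where
    no-shorter : (¬ T (any (λ j → walk (suc N) j u y) (upTo k)))
               ⇔ (∀ j → j < k → ¬ Walk j (toℕ u) (toℕ y))
    no-shorter = mk⇔
      (λ ¬shorter j j<k w → ¬shorter (from T-any-upTo (j , j<k , from (T-walk j u y) w)))
      (λ none shorter → let (j , j<k , w) = to T-any-upTo shorter in none j j<k (to (T-walk j u y) w))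

  module _ (D : Subset N) where

    Near : ℕ → ℕ → Set
    Near a b = ∃ λ i → i ∈ D × Dist a b (toℕ i)

    near? : ∀ a b → Dec (Near a b)
    near? a b = any? λ i → i ∈? D ×-dec dist? a b (toℕ i)

    near : ℕ → ℕ → Bool
    near a b = does (near? a b)

    inN≡near : ∀ v y → inN (suc N) D v y ≡ near (toℕ v) (toℕ y)
    inN≡near v y = does-⇔ T-inN (T? _) (near? _ _)
      where
      T-inN : T (inN (suc N) D v y) ⇔ Near (toℕ v) (toℕ y)
      T-inN = ⇔.trans T-any-allFin (∃-cong-⇔ (⇔.trans T-∧ (T-lookup ×-⇔ T-distIs v y _)))

    near-shift : ∀ a b → b < N → near (suc a) (suc b) ≡ near a b
    near-shift a b b<N = does-⇔ (∃-cong-⇔ (⇔.refl ×-⇔ dist-shift b<N)) (near? _ _) (near? _ _)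

    ¬near-to-0 : ∀ a → near (suc a) 0 ≡ false
    ¬near-to-0 a = dec-false (near? _ _) (¬dist-to-0 ∘ proj₂ ∘ proj₂)

    near-from-top⇒minAtMostOne : ∀ {a b} → N ≤ suc a → b ≤ N → Near a b → MinAtMostOne (suc N) D
    near-from-top⇒minAtMostOne N≤1+a b≤N (i , i∈D , d) = i , i∈D , dist-from-top N≤1+a b≤N d

    minAtMostOne⇒near : MinAtMostOne (suc N) D → ∀ {a} → a < N → ∃ λ b → b ≤ N × Near a b
    minAtMostOne⇒near (i , i∈D , i≤1) a<N = let (b≤N , d) = dist-to-a+k a<N i≤1 in _ , b≤N , i , i∈D , d

-- The labelling f(a) = N + 1 − a of vertices 0,…,N; ω a is the weight of a when
-- nbhd a b says that b is in the neighbourhood of a.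
module ReverseLabelling (N : ℕ) (nbhd : ℕ → ℕ → Bool) where

  contribution : ℕ → ℕ → ℕ
  contribution a b = if nbhd a b then suc N ∸ b else 0

  indicator : ℕ → ℕ → ℕ
  indicator a b = if nbhd a b then 1 else 0

  ω : ℕ → ℕ
  ω a = ∑[ y < suc N ] contribution a (toℕ y)

  degree : ℕ → ℕ
  degree a = ∑[ y < suc N ] indicator a (toℕ y)

  module _ (a : ℕ) (¬nbhd-to-0 : nbhd (suc a) 0 ≡ false)
           (nbhd-shift : ∀ b → b < N → nbhd (suc a) (suc b) ≡ nbhd a b) where

    contribution-split : ∀ b → b < N → contribution a b ≡ contribution (suc a) (suc b) + indicator a b
    contribution-split b b<N rewrite nbhd-shift b b<N with nbhd a b
    ... | true  = trans (+-∸-assoc 1 (<⇒≤ b<N)) (+-comm 1 (N ∸ b))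
    ... | false = refl

    contribution-last : contribution a N ≡ indicator a N
    contribution-last with nbhd a N
    ... | true  = m+n∸n≡m 1 N
    ... | false = refl

    ω-step : ω a ≡ ω (suc a) + degree a
    ω-step = begin
      ω a
        ≡⟨ sum-init-lastℕ N (contribution a) ⟩
      ∑[ y < N ] contribution a (toℕ y) + contribution a N
        ≡⟨ cong₂ _+_ (sum-cong-≗ {N} (λ y → contribution-split (toℕ y) (toℕ<n y))) contribution-last ⟩
      ∑[ y < N ] (contribution (suc a) (suc (toℕ y)) + indicator a (toℕ y)) + indicator a N
        ≡⟨ cong (_+ indicator a N) (∑-distrib-+ {N} _ _) ⟩
      shifted + init-degree + indicator a N
        ≡⟨ +-assoc shifted init-degree (indicator a N) ⟩
      shifted + (init-degree + indicator a N)
        ≡⟨ cong₂ _+_ (sym ω-suc) (sym (sum-init-lastℕ N (indicator a))) ⟩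
      ω (suc a) + degree a
        ∎
      where
      open ≡-Reasoning
      shifted = ∑[ y < N ] contribution (suc a) (suc (toℕ y))
      init-degree = ∑[ y < N ] indicator a (toℕ y)
      ω-suc : ω (suc a) ≡ shifted
      ω-suc rewrite ¬nbhd-to-0 = refl

    ω-suc< : ∀ {b} → nbhd a b ≡ true → b ≤ N → ω (suc a) < ω a
    ω-suc< {b} nbhd-ab b≤N = subst (ω (suc a) <_) (sym ω-step) (m<m+n (ω (suc a)) degree-pos)
      where
      degree-pos : 0 < degree a
      degree-pos = subst (_≤ degree a) indicator-b≡1 (term≤sum (indicator a ∘ toℕ) (fromℕ< (s≤s b≤N)))
        where
        indicator-b≡1 : indicator a (toℕ (fromℕ< (s≤s b≤N))) ≡ 1
        indicator-b≡1 rewrite toℕ-fromℕ< (s≤s b≤N) | nbhd-ab = refl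

weight-vanishes : ∀ n D π v → (∀ y → inN n D v y ≡ false) → weight n D π v ≡ 0
weight-vanishes n D π v ∉N = begin
  weight n D π v                                       ≡⟨ sum-allFin {n} _ ⟩
  ∑[ y < n ] (if inN n D v y then label n π y else 0)  ≡⟨ sum-cong-≗ {n} (cong (if_then _ else 0) ∘ ∉N) ⟩
  ∑[ y < n ] 0                                         ≡⟨ sum-replicate-zero n ⟩
  0                                                    ∎
  where open ≡-Reasoning

label-reverse : ∀ {N} (y : Fin (suc N)) → label (suc N) reverse y ≡ suc N ∸ toℕ y
label-reverse y = trans (cong suc (opposite-prop y)) (sym (+-∸-assoc 1 (toℕ≤pred[n] y)))

module _ {N : ℕ} (2≤N : 2 ≤ N) (D : Subset N) where

  open ThetaCycle N 2≤N
  open ReverseLabelling N (near D)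

  weight-reverse : ∀ v → weight (suc N) D reverse v ≡ ω (toℕ v)
  weight-reverse v = trans (sum-allFin {suc N} _) (sum-cong-≗ {suc N} term)
    where
    term : ∀ y → (if inN (suc N) D v y then label (suc N) reverse y else 0) ≡ contribution (toℕ v) (toℕ y)
    term y rewrite inN≡near D v y | label-reverse y = refl

  minAtMostOne⇒reverse-antimagic : MinAtMostOne (suc N) D → IsDAntimagicLabeling (suc N) D reverse
  minAtMostOne⇒reverse-antimagic min {u} {v} ωu≡ωv =
    toℕ-injective (stepDecreasing⇒injective ω-decreasing (toℕ≤N u) (toℕ≤N v)
      (trans (sym (weight-reverse u)) (trans ωu≡ωv (weight-reverse v))))
    where
    ω-decreasing : StepDecreasingUpTo N ω
    ω-decreasing a a<N with minAtMostOne⇒near D min a<N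
    ... | b , b≤N , a~b = ω-suc< a (¬near-to-0 D a) (near-shift D a) (dec-true (near? D a b) a~b) b≤N

  antimagic⇒minAtMostOne : ThetaCycleDAntimagic (suc N) D → MinAtMostOne (suc N) D
  -- Otherwise the two top vertices have empty neighbourhoods, hence equal weights.
  antimagic⇒minAtMostOne (π , antimagic) =
    decidable-stable (any? λ i → i ∈? D ×-dec toℕ i ≤? 1) λ ¬min →
      top≢belowTop (antimagic (trans (vanishes ¬min top top≥) (sym (vanishes ¬min belowTop belowTop≥))))
    where
    instance
      _ : NonZero N
      _ = ≢-nonZero N≢0
    top belowTop : Fin (suc N)
    top = fromℕ N
    belowTop = fromℕ< {pred N} (s≤s pred[n]≤n)
    suc-belowTop : suc (toℕ belowTop) ≡ N
    suc-belowTop = trans (cong suc (toℕ-fromℕ< (s≤s pred[n]≤n))) (suc-pred N)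
    top≥ : N ≤ suc (toℕ top)
    top≥ = subst (λ t → N ≤ suc t) (sym (toℕ-fromℕ N)) (n≤1+n N)
    belowTop≥ : N ≤ suc (toℕ belowTop)
    belowTop≥ = ≤-reflexive (sym suc-belowTop)
    top≢belowTop : top ≢ belowTop
    top≢belowTop top≡belowTop =
      1+n≢n (trans suc-belowTop (trans (sym (toℕ-fromℕ N)) (cong toℕ top≡belowTop)))
    vanishes : ¬ MinAtMostOne (suc N) D → ∀ v → N ≤ suc (toℕ v) → weight (suc N) D π v ≡ 0
    vanishes ¬min v N≤1+v = weight-vanishes (suc N) D π v λ y →
      trans (inN≡near D v y)
            (dec-false (near? D _ _) (¬min ∘ near-from-top⇒minAtMostOne D N≤1+v (toℕ≤N y)))

mainTheorem3 : (n : ℕ) → 3 ≤ n → (D : Subset (n ∸ 1)) → Nonempty D →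
    (ThetaCycleDAntimagic n D ⇔ MinAtMostOne n D)
mainTheorem3 (suc N) (s≤s 2≤N) D _ =
  mk⇔ (antimagic⇒minAtMostOne 2≤N D) (λ min → reverse , minAtMostOne⇒reverse-antimagic 2≤N D min)
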